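{- Let $X_1,\dots,X_k,Y$ be NUTS and $t\subseteq\mathcal M_{\mathrm{fin}}(|X_1|)\times\dots\times\mathcal M_{\mathrm{fin}}(|X_k|)\times|Y|$. Then $t\in\mathbf{NUTS}(!X_1\otimes\dots\otimes!X_k,Y)$ if and only if for all $(u_1,\dots,u_k)\in\prod_{i=1}^k\mathcal T(X_i)$ one has $t\cdot(\mathcal M_{\mathrm{fin}}(u_1)\times\dots\times\mathcal M_{\mathrm{fin}}(u_k))\in\mathcal T(Y)$.
   Context: $\mathcal M_{\mathrm{fin}}(E)$ is the set of finite multisets of elements of $E$. For $\mathcal T\subseteq\mathcal P(E)$, $\mathcal T^\perp=\{u'\subseteq E\mid\forall u\in\mathcal T,\ u\cap u'\neq\emptyset\}$. A NUTS is $X=(|X|,\mathcal T(X))$ with $\mathcal T(X)\subseteq\mathcal P(|X|)$ and $\mathcal T(X)=\mathcal T(X)^{\perp\perp}$; $X^\perp=(|X|,\mathcal T(X)^\perp)$, $X\otimes Y=(|X|\times|Y|,\{u\times v\mid u\in\mathcal T(X),v\in\mathcal T(Y)\}^{\perp\perp})$ (iterated tensors identified with tuples), $X\multimap Y=(X\otimes Y^\perp)^\perp$, $\mathbf{NUTS}(X,Y)=\mathcal T(X\multimap Y)$. $!X=(\mathcal M_{\mathrm{fin}}(|X|),\{\mathcal M_{\mathrm{fin}}(u)\mid u\in\mathcal T(X)\}^{\perp\perp})$. For $t\subseteq E\times F$ and $u\subseteq E$, $t\cdot u=\{b\mid\exists a\in u,(a,b)\in t\}$. -}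

module Defs where

open import Data.Nat using (ℕ; zero; suc)
open import Data.Fin using (Fin; zero; suc)
open import Data.Product using (Σ; ∃; _×_; _,_; proj₁; proj₂)
open import Data.Unit using (⊤; tt)
open import Level using (Lift; lift)
open import Data.List using (List)
open import Data.List.Relation.Unary.All using (All)
open import Function using (_∘_; _⇔_)

Subset : Set → Set₁
Subset E = E → Set

Family : Set → Set₂
Family E = Subset E → Set₁

_≐_ : {E : Set} → Subset E → Subset E → Set
u ≐ v = ∀ a → (u a → v a) × (v a → u a)

-- u ∩ u' ≠ ∅ (constructively: an explicit common element).
Meets : {E : Set} → Subset E → Subset E → Set
Meets {E} u u' = Σ E (λ a → u a × u' a)

_⊥ : {E : Set} → Family E → Family E
(𝒯 ⊥) u' = (u : Subset _) → 𝒯 u → Meets u u'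

-- A "space": a web together with a family of subsets (not necessarily closed).
record Space : Set₂ where
  field
    web : Set
    𝒯   : Family web
open Space public

IsNUTS : Space → Set₁
IsNUTS X = ∀ u → 𝒯 X u ⇔ ((𝒯 X ⊥) ⊥) u

_^⊥ : Space → Space
X ^⊥ = record { web = web X ; 𝒯 = 𝒯 X ⊥ }

_×ˢ_ : {A B : Set} → Subset A → Subset B → Subset (A × B)
(u ×ˢ v) p = u (proj₁ p) × v (proj₂ p)

_⊗_ : Space → Space → Space
X ⊗ Y = record
  { web = web X × web Y
  ; 𝒯 = (gen ⊥) ⊥ }
  where
  gen : Family (web X × web Y)
  gen w = Σ (Subset (web X)) λ u → Σ (Subset (web Y)) λ v →
            𝒯 X u × 𝒯 Y v × (w ≐ (u ×ˢ v))

_⊸_ : Space → Space → Space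
X ⊸ Y = (X ⊗ (Y ^⊥)) ^⊥

NUTS[_,_] : (X Y : Space) → Family (web X × web Y)
NUTS[ X , Y ] = 𝒯 (X ⊸ Y)

-- Finite multisets over E are represented by lists (up to permutation).
-- ℳ_fin(u) = multisets all of whose elements lie in u.
Mfin : {E : Set} → Subset E → Subset (List E)
Mfin u = All u

! : Space → Space
! X = record
  { web = List (web X)
  ; 𝒯 = (gen ⊥) ⊥ }
  where
  gen : Family (List (web X))
  gen w = Σ (Subset (web X)) λ u → 𝒯 X u × (w ≐ Mfin u)

𝟙 : Space
𝟙 = record { web = ⊤ ; 𝒯 = (gen ⊥) ⊥ }
  where
  gen : Family ⊤
  gen w = Lift _ (w ≐ (λ _ → ⊤))

⨂ : (k : ℕ) → (Fin k → Space) → Space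
⨂ zero X = 𝟙
⨂ (suc zero) X = X zero
⨂ (suc (suc n)) X = X zero ⊗ ⨂ (suc n) (X ∘ suc)

∏ : (k : ℕ) → (X : Fin k → Space) → ((i : Fin k) → Subset (web (X i))) →
    Subset (web (⨂ k X))
∏ zero X us = λ _ → ⊤
∏ (suc zero) X us = us zero
∏ (suc (suc n)) X us = us zero ×ˢ ∏ (suc n) (X ∘ suc) (us ∘ suc)

Pointwise : (k : ℕ) → (X : Fin k → Space) →
            ((i : Fin k) → web (X i) → web (X i) → Set) →
            web (⨂ k X) → web (⨂ k X) → Set
Pointwise zero X R a b = ⊤
Pointwise (suc zero) X R a b = R zero a b
Pointwise (suc (suc n)) X R (a , as) (b , bs) =
  R zero a b × Pointwise (suc n) (X ∘ suc) (R ∘ suc) as bs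

_·_ : {E F : Set} → Subset (E × F) → Subset E → Subset F
(t · u) b = Σ _ λ a → u a × t (a , b)

-- A subset w of the web of !X₁ ⊗ … ⊗ !X_k is orthogonal to every u of the tensor as soon as it
-- meets every box ℳ_fin(u₁) × … × ℳ_fin(u_k): for !X this is the definition of its
-- bi-orthogonal closure, and for a tensor A ⊗ B it follows by slicing w along one coordinate.
-- Given this, t ⊆ A × |Y| is a morphism iff it sends the boxes into 𝒯(Y), as a box u and
-- v ∈ 𝒯(Y)^⊥ meet t exactly when t · u meets v.
module Submission where

open import Defs
open import Data.Nat using (ℕ; zero; suc)
open import Data.Fin using (Fin; zero; suc)
open import Data.Product using (Σ; _×_; _,_; proj₁; proj₂)
open import Level using (lift)
open import Data.List.Relation.Binary.Permutation.Propositional using (_↭_)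
open import Function using (_∘_; _⇔_; id; mk⇔)
open import Function.Bundles using (module Equivalence)

private
  variable
    E F : Set

_⊆_ : Subset E → Subset E → Set
u ⊆ v = ∀ a → u a → v a

≐⇒⊇ : {u v : Subset E} → u ≐ v → v ⊆ u
≐⇒⊇ eq a = proj₂ (eq a)

≐-refl : {u : Subset E} → u ≐ u
≐-refl a = id , id

_ᵀ : Subset (E × F) → Subset (F × E)
(t ᵀ) (b , a) = t (a , b)

Meets-sym : {u v : Subset E} → Meets u v → Meets v u
Meets-sym (a , ua , va) = a , va , ua

Meets-⊆ : {u u′ w : Subset E} → u ⊆ u′ → Meets u w → Meets u′ w
Meets-⊆ u⊆u′ (a , ua , wa) = a , u⊆u′ a ua , wa

×ˢ-Meets⇒·-Meets : {u : Subset E} {v : Subset F} {t : Subset (E × F)} →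
  Meets (u ×ˢ v) t → Meets (t · u) v
×ˢ-Meets⇒·-Meets ((a , b) , (ua , vb) , tab) = b , (a , ua , tab) , vb

·-Meets⇒ᵀ·-Meets : {u : Subset E} {v : Subset F} {t : Subset (E × F)} →
  Meets (t · u) v → Meets u ((t ᵀ) · v)
·-Meets⇒ᵀ·-Meets (b , (a , ua , tab) , vb) = a , ua , (b , vb , tab)

ᵀ·-Meets⇒×ˢ-Meets : {u : Subset E} {v : Subset F} {t : Subset (E × F)} →
  Meets u ((t ᵀ) · v) → Meets (u ×ˢ v) t
ᵀ·-Meets⇒×ˢ-Meets (a , ua , (b , vb , tab)) = (a , b) , (ua , vb) , tab

⊥⊥-intro : {𝒢 : Family E} {u : Subset E} → 𝒢 u → ((𝒢 ⊥) ⊥) u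
⊥⊥-intro 𝒢u u′ u′∈𝒢⊥ = Meets-sym (u′∈𝒢⊥ _ 𝒢u)

Orth : {I : Set₁} → (I → Subset E) → Subset E → Set₁
Orth S w = ∀ i → Meets (S i) w

Generates : {I : Set₁} (X : Space) → (I → Subset (web X)) → Set₁
Generates X S = ∀ w → Orth S w → (𝒯 X ⊥) w

Generates-⊥⊥ : {I : Set₁} {𝒢 : Family E} (S : I → Subset E) →
  (∀ v → 𝒢 v → Σ I λ i → S i ⊆ v) → ∀ w → Orth S w → ((𝒢 ⊥) ⊥ ⊥) w
Generates-⊥⊥ S below w w⊥S u u∈𝒢⊥⊥ = Meets-sym (u∈𝒢⊥⊥ w λ v 𝒢v →
  let (i , Si⊆v) = below v 𝒢v in Meets-⊆ Si⊆v (w⊥S i))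

Generates-reindex : {I J : Set₁} {X : Space} {S : I → Subset (web X)}
  (S′ : J → Subset (web X)) (f : I → J) →
  (∀ i → S′ (f i) ⊆ S i) → Generates X S → Generates X S′
Generates-reindex S′ f S′f⊆S gen w w⊥S′ = gen w λ i → Meets-⊆ (S′f⊆S i) (w⊥S′ (f i))

opens : (X : Space) → Σ (Subset (web X)) (𝒯 X) → Subset (web X)
opens X = proj₁

Rect : {I J : Set₁} → (I → Subset E) → (J → Subset F) → I × J → Subset (E × F)
Rect SA SB (i , j) = SA i ×ˢ SB j

!-generated : (X : Space) → Generates (! X) (Mfin ∘ opens X)
!-generated X = Generates-⊥⊥ (Mfin ∘ opens X)
  λ { v (u , u∈ , v≐) → (u , u∈) , ≐⇒⊇ v≐ }

⊗-generated-by-opens : (A B : Space) → Generates (A ⊗ B) (Rect (opens A) (opens B))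
⊗-generated-by-opens A B = Generates-⊥⊥ (Rect (opens A) (opens B))
  λ { w (u , v , u∈ , v∈ , w≐) → ((u , u∈) , (v , v∈)) , ≐⇒⊇ w≐ }

-- Slice w at v, then at each SA-set u₀: the slice w · u₀ lies in SB^⊥ ⊆ 𝒯(B)^⊥, so it meets v.
⊗-generated : {I J : Set₁} (A B : Space) {SA : I → Subset (web A)} {SB : J → Subset (web B)} →
  Generates A SA → Generates B SB → Generates (A ⊗ B) (Rect SA SB)
⊗-generated A B {SA} {SB} genA genB w w⊥SA×SB =
  ⊗-generated-by-opens A B w λ { ((u , u∈) , (v , v∈)) →
    ᵀ·-Meets⇒×ˢ-Meets (genA ((w ᵀ) · v) (w-slice⊥SA v v∈) u u∈) }
  where
  w-slice⊥SA : ∀ v → 𝒯 B v → Orth SA ((w ᵀ) · v)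
  w-slice⊥SA v v∈ i = ·-Meets⇒ᵀ·-Meets (Meets-sym (genB (w · SA i) w·SAi⊥SB v v∈))
    where
    w·SAi⊥SB : Orth SB (w · SA i)
    w·SAi⊥SB j = Meets-sym (×ˢ-Meets⇒·-Meets (w⊥SA×SB (i , j)))

BoxIndex : (k : ℕ) → (Fin k → Space) → Set₁
BoxIndex k X = Σ ((i : Fin k) → Subset (web (X i))) λ us → ∀ i → 𝒯 (X i) (us i)

box : (k : ℕ) (X : Fin k → Space) → BoxIndex k X → Subset (web (⨂ k (! ∘ X)))
box k X (us , _) = ∏ k (! ∘ X) (Mfin ∘ us)

cons-box : {n : ℕ} {X : Fin (suc n) → Space} →
  Σ (Subset (web (X zero))) (𝒯 (X zero)) → BoxIndex n (X ∘ suc) → BoxIndex (suc n) X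
cons-box (u , u∈) (us , us∈) = (λ { zero → u ; (suc i) → us i })
                             , (λ { zero → u∈ ; (suc i) → us∈ i })

⨂!-generated : (k : ℕ) (X : Fin k → Space) → Generates (⨂ k (! ∘ X)) (box k X)
⨂!-generated zero X = Generates-⊥⊥ (box zero X)
  λ { v (lift v≐⊤) → ((λ ()) , (λ ())) , ≐⇒⊇ v≐⊤ }
⨂!-generated (suc zero) X =
  Generates-reindex (box 1 X) (λ u → cons-box {X = X} u ((λ ()) , (λ ()))) (λ _ _ → id)
    (!-generated (X zero))
⨂!-generated (suc (suc n)) X =
  Generates-reindex (box (suc (suc n)) X) (λ (u , us) → cons-box {X = X} u us) (λ _ _ → id)
    (⊗-generated (! (X zero)) (⨂ (suc n) (! ∘ X ∘ suc))
      (!-generated (X zero)) (⨂!-generated (suc n) (X ∘ suc)))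

×ˢ-∈-⊗ : (A B : Space) {u : Subset (web A)} {v : Subset (web B)} →
  𝒯 A u → 𝒯 B v → 𝒯 (A ⊗ B) (u ×ˢ v)
×ˢ-∈-⊗ A B {u} {v} u∈ v∈ = ⊥⊥-intro (u , v , u∈ , v∈ , ≐-refl)

Mfin-∈-! : (X : Space) {u : Subset (web X)} → 𝒯 X u → 𝒯 (! X) (Mfin u)
Mfin-∈-! X {u} u∈ = ⊥⊥-intro (u , u∈ , ≐-refl)

box-∈-⨂! : (k : ℕ) (X : Fin k → Space) (i : BoxIndex k X) → 𝒯 (⨂ k (! ∘ X)) (box k X i)
box-∈-⨂! zero X _ = ⊥⊥-intro (lift ≐-refl)
box-∈-⨂! (suc zero) X (us , us∈) = Mfin-∈-! (X zero) (us∈ zero)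
box-∈-⨂! (suc (suc n)) X (us , us∈) =
  ×ˢ-∈-⊗ (! (X zero)) (⨂ (suc n) (! ∘ X ∘ suc))
    (Mfin-∈-! (X zero) (us∈ zero)) (box-∈-⨂! (suc n) (X ∘ suc) (us ∘ suc , us∈ ∘ suc))

⊸-apply : (A B : Space) → IsNUTS B → {t : Subset (web A × web B)} {u : Subset (web A)} →
  NUTS[ A , B ] t → 𝒯 A u → 𝒯 B (t · u)
⊸-apply A B B-nuts {t} {u} t∈ u∈ = Equivalence.from (B-nuts (t · u)) λ v v∈ →
  Meets-sym (×ˢ-Meets⇒·-Meets (t∈ (u ×ˢ v) (×ˢ-∈-⊗ A (B ^⊥) u∈ v∈)))

⊸-intro : {I : Set₁} (A B : Space) {S : I → Subset (web A)} → Generates A S →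
  {t : Subset (web A × web B)} → (∀ i → 𝒯 B (t · S i)) → NUTS[ A , B ] t
⊸-intro A B {S} genA {t} t·S∈ = ⊗-generated-by-opens A (B ^⊥) t λ { ((u , u∈) , (v , v∈)) → ᵀ·-Meets⇒×ˢ-Meets (genA ((t ᵀ) · v)
        (λ i → ·-Meets⇒ᵀ·-Meets (v∈ (t · S i) (t·S∈ i))) u u∈) }

lemma4p8 : (k : ℕ) (X : Fin k → Space) → (∀ i → IsNUTS (X i)) →
    (Y : Space) → IsNUTS Y →
    (t : Subset (web (⨂ k (! ∘ X)) × web Y)) →
    (∀ as as′ b → Pointwise k (! ∘ X) (λ i → _↭_) as as′ → t (as , b) → t (as′ , b)) →
    NUTS[ ⨂ k (! ∘ X) , Y ] t ⇔
      ((us : (i : Fin k) → Subset (web (X i))) → (∀ i → 𝒯 (X i) (us i)) →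
        𝒯 Y (t · ∏ k (! ∘ X) (λ i → Mfin (us i))))
lemma4p8 k X _ Y Y-nuts t _ = mk⇔
  (λ t∈ us us∈ → ⊸-apply (⨂ k (! ∘ X)) Y Y-nuts t∈ (box-∈-⨂! k X (us , us∈)))
  (λ t·box∈ → ⊸-intro (⨂ k (! ∘ X)) Y (⨂!-generated k X) λ (us , us∈) → t·box∈ us us∈)
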